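{- The set $L_{1,\emptyset}$ of polynomials in $\mathbb{Z}[x]$ of degree at least 1 that are locally nilpotent at $1$ consists exactly of the following polynomials: (1) $(x-1)p(x)$ with $p(x)\in\mathbb{Z}[x]\setminus\{0\}$ (nilpotent at 1 of nilpotency index 1); (2) $-2x+4+p(x)(x-1)(x-2)$ with $p(x)\in\mathbb{Z}[x]$ (nilpotent at 1 of nilpotency index 2); (3) $-2x^2+7x-3+p(x)(x-1)(x-2)(x-3)$ with $p(x)\in\mathbb{Z}[x]$ (nilpotent at 1 of nilpotency index 3); (4) $x+1$ (locally nilpotent at 1 but not nilpotent at 1).
   Context: $\mathbb{N}$ denotes the positive integers. For $u\in\mathbb{Z}[x]$ of degree at least 1, $u^{(1)}=u$ and $u^{(n+1)}=u\circ u^{(n)}$. $u$ is locally nilpotent at $r\in\mathbb{Z}$ if for every prime $p$ there is $m\in\mathbb{N}$ with $u^{(m)}(r)\equiv 0\pmod p$; $L_{r,\emptyset}$ denotes the set of all such polynomials (of any degree $\ge1$). $u$ is nilpotent at $r$ if $u^{(n)}(r)=0$ for some $n\in\mathbb{N}$, and the least such $n$ is the nilpotency index. -}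

module Defs where

open import Data.Nat as ℕ using (ℕ; zero; suc)
open import Data.Integer as ℤ using (ℤ; +_; -[1+_])
open import Data.Integer.Divisibility using (_∣_)
open import Data.Nat.Primality using (Prime)
open import Data.List using (List; []; _∷_; map)
open import Data.Product using (Σ; ∃; _×_; _,_)
open import Relation.Binary.PropositionalEquality using (_≡_)
open import Relation.Nullary using (¬_)

-- Polynomials in ℤ[x] as coefficient lists, constant coefficient first.
-- Trailing zeros are allowed; polynomial equality is coefficientwise (_≈ₚ_).
Poly : Set
Poly = List ℤ

coeff : Poly → ℕ → ℤ
coeff []       n       = + 0
coeff (a ∷ p)  zero    = a
coeff (a ∷ p)  (suc n) = coeff p n

_≈ₚ_ : Poly → Poly → Set
p ≈ₚ q = ∀ n → coeff p n ≡ coeff q n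

0ₚ : Poly
0ₚ = []

DegreeAtLeast1 : Poly → Set
DegreeAtLeast1 p = ∃ λ n → ¬ (coeff p (suc n) ≡ + 0)

_+ₚ_ : Poly → Poly → Poly
[]      +ₚ q       = q
(a ∷ p) +ₚ []      = a ∷ p
(a ∷ p) +ₚ (b ∷ q) = (a ℤ.+ b) ∷ (p +ₚ q)

_*ₚ_ : Poly → Poly → Poly
[]      *ₚ q = []
(a ∷ p) *ₚ q = map (a ℤ.*_) q +ₚ (+ 0 ∷ (p *ₚ q))

eval : Poly → ℤ → ℤ
eval []      r = + 0
eval (a ∷ p) r = a ℤ.+ r ℤ.* eval p r

iterate : Poly → ℕ → ℤ → ℤ
iterate u zero    r = r
iterate u (suc n) r = eval u (iterate u n r)

LocallyNilpotentAt : Poly → ℤ → Set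
LocallyNilpotentAt u r =
  ∀ (p : ℕ) → Prime p → ∃ λ m → (+ p) ∣ iterate u (suc m) r

NilpotentAt : Poly → ℤ → Set
NilpotentAt u r = ∃ λ m → iterate u (suc m) r ≡ + 0

NilpotencyIndex : Poly → ℤ → ℕ → Set
NilpotencyIndex u r k =
  (1 ℕ.≤ k) × (iterate u k r ≡ + 0) ×
  (∀ m → 1 ℕ.≤ m → m ℕ.< k → ¬ (iterate u m r ≡ + 0))

xm1 : Poly
xm1 = -[1+ 0 ] ∷ + 1 ∷ []

xm2 : Poly
xm2 = -[1+ 1 ] ∷ + 1 ∷ []

xm3 : Poly
xm3 = -[1+ 2 ] ∷ + 1 ∷ []

-- -2x + 4
lin2 : Poly
lin2 = + 4 ∷ -[1+ 1 ] ∷ []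

-- -2x^2 + 7x - 3
quad3 : Poly
quad3 = -[1+ 2 ] ∷ + 7 ∷ -[1+ 1 ] ∷ []

xp1 : Poly
xp1 = + 1 ∷ + 1 ∷ []

Family1 : Poly → Set
Family1 u = Σ Poly λ p → ¬ (p ≈ₚ 0ₚ) × (u ≈ₚ (xm1 *ₚ p))

Family2 : Poly → Set
Family2 u = Σ Poly λ p → u ≈ₚ (lin2 +ₚ ((p *ₚ xm1) *ₚ xm2))

Family3 : Poly → Set
Family3 u = Σ Poly λ p → u ≈ₚ (quad3 +ₚ (((p *ₚ xm1) *ₚ xm2) *ₚ xm3))

Family4 : Poly → Set
Family4 u = u ≈ₚ xp1

{-# OPTIONS --safe #-}
module Submission where

-- Let a n be the n-th iterate of u at 1.  Since x − y divides u x − u y, a congruence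
-- a (n+1) ≡ a j (mod d) with j ≤ n makes the orbit periodic mod d from j on, so every
-- a M is congruent to one of a 0, …, a n.  Suppose a i = i + 1 for i ≤ n and put
-- D = a (n+1) − (n+2).  Local nilpotency then bounds every prime factor of
-- D + m = a (n+1) − a (n+1−m) by n + 1, and shifting a (k+l) − a l = k gives k ∣ D
-- for k ≤ n.  These two facts force D = 0, or D = −(n+2) with n ≤ 2.  So either the
-- orbit is 1, 2, 3, … and u agrees with x + 1 on all positive integers, or it reaches 0
-- after one, two or three steps, and dividing u successively by x − 1, x − 2, x − 3
-- exhibits it in the corresponding family.

open import Defs
open import Data.Nat as ℕ using (ℕ; zero; suc; _≤_; _<_; z≤n; s≤s; _!)
import Data.Nat.Properties as ℕₚ
open import Data.Nat.Divisibility as ℕ∣ using () renaming (_∣_ to _∣ₙ_)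
open import Data.Nat.Induction using (<-wellFounded)
open import Data.Nat.Primality
  using (Prime; ¬prime[0]; ¬prime[1]; prime⇒irreducible; prime⇒nonTrivial)
open import Data.Nat.Primality.Factorisation using (factorise)
open import Data.Nat.ListAction using (product)
open import Data.Integer as ℤ using (ℤ; +_; -[1+_]; _+_; _*_; _-_; -_; 0ℤ; 1ℤ; -1ℤ)
import Data.Integer.Properties as ℤₚ
import Data.Integer.Divisibility as Unsigned
open import Data.Integer.Divisibility.Signed
  using (_∣_; divides; ∣⇒∣ᵤ; ∣ᵤ⇒∣; ∣-refl; ∣-trans; ∣m∣n⇒∣m+n; ∣m∣n⇒∣m-n)
open import Data.Integer.Tactic.RingSolver using (solve-∀)
open import Data.List using ([]; _∷_; map; length; foldl)
open import Data.List.Relation.Unary.All using (_∷_)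
open import Data.Product using (∃-syntax; _×_; _,_)
open import Data.Sum using (_⊎_; inj₁; inj₂)
open import Data.Empty using (⊥-elim)
open import Function using (_∘_)
open import Induction.WellFounded using (Acc; acc)
open import Relation.Nullary using (¬_; yes; no)
open import Relation.Binary.PropositionalEquality
open ≡-Reasoning

solve-for-left : ∀ {x y z} → x + y ≡ z → x ≡ z - y
solve-for-left {x} {y} refl = identity x y
  where
  identity : ∀ x y → x ≡ x + y - y
  identity = solve-∀

affine-injective : ∀ a b {y y₀} .{{_ : ℕ.NonZero ℤ.∣ a ∣}} → a * y + b ≡ a * y₀ + b → y ≡ y₀
affine-injective a b {y} {y₀} eq =
  ℤₚ.*-cancelˡ-≡ a y y₀ (trans (solve-for-left eq) (identity a y₀ b))
  where
  identity : ∀ a y b → a * y + b - b ≡ a * y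
  identity = solve-∀

∣-difference-trans : ∀ {d x y z} → d ∣ x - y → d ∣ y - z → d ∣ x - z
∣-difference-trans {d} {x} {y} {z} d∣x-y d∣y-z =
  subst (d ∣_) (identity x y z) (∣m∣n⇒∣m+n d∣x-y d∣y-z)
  where
  identity : ∀ x y z → x - y + (y - z) ≡ x - z
  identity = solve-∀

coeff-+ : ∀ p q n → coeff (p +ₚ q) n ≡ coeff p n + coeff q n
coeff-+ []      q       n       = sym (ℤₚ.+-identityˡ _)
coeff-+ (a ∷ p) []      n       = sym (ℤₚ.+-identityʳ _)
coeff-+ (a ∷ p) (b ∷ q) zero    = refl
coeff-+ (a ∷ p) (b ∷ q) (suc n) = coeff-+ p q n

coeff-scale : ∀ a q n → coeff (map (a *_) q) n ≡ a * coeff q n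
coeff-scale a []      n       = sym (ℤₚ.*-zeroʳ a)
coeff-scale a (b ∷ q) zero    = refl
coeff-scale a (b ∷ q) (suc n) = coeff-scale a q n

eval-+ : ∀ p q x → eval (p +ₚ q) x ≡ eval p x + eval q x
eval-+ []      q       x = sym (ℤₚ.+-identityˡ _)
eval-+ (a ∷ p) []      x = sym (ℤₚ.+-identityʳ _)
eval-+ (a ∷ p) (b ∷ q) x =
  trans (cong (λ v → a + b + x * v) (eval-+ p q x)) (identity a b x (eval p x) (eval q x))
  where
  identity : ∀ a b x v w → a + b + x * (v + w) ≡ a + x * v + (b + x * w)
  identity = solve-∀

eval-scale : ∀ a q x → eval (map (a *_) q) x ≡ a * eval q x
eval-scale a []      x = sym (ℤₚ.*-zeroʳ a)
eval-scale a (b ∷ q) x =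
  trans (cong (λ v → a * b + x * v) (eval-scale a q x)) (identity a b x (eval q x))
  where
  identity : ∀ a b x v → a * b + x * (a * v) ≡ a * (b + x * v)
  identity = solve-∀

eval-* : ∀ p q x → eval (p *ₚ q) x ≡ eval p x * eval q x
eval-* []      q x = refl
eval-* (a ∷ p) q x = begin
  eval (map (a *_) q +ₚ (0ℤ ∷ p *ₚ q)) x
    ≡⟨ eval-+ (map (a *_) q) (0ℤ ∷ p *ₚ q) x ⟩
  eval (map (a *_) q) x + (0ℤ + x * eval (p *ₚ q) x)
    ≡⟨ cong₂ (λ v w → v + (0ℤ + x * w)) (eval-scale a q x) (eval-* p q x) ⟩
  a * eval q x + (0ℤ + x * (eval p x * eval q x))
    ≡⟨ identity a x (eval p x) (eval q x) ⟩
  (a + x * eval p x) * eval q x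
    ∎
  where
  identity : ∀ a x v w → a * w + (0ℤ + x * (v * w)) ≡ (a + x * v) * w
  identity = solve-∀

eval-≈0 : ∀ p x → p ≈ₚ 0ₚ → eval p x ≡ 0ℤ
eval-≈0 []      x p≈0 = refl
eval-≈0 (a ∷ p) x p≈0 rewrite p≈0 0 | eval-≈0 p x (p≈0 ∘ suc) =
  trans (ℤₚ.+-identityˡ _) (ℤₚ.*-zeroʳ x)

eval-≈ : ∀ p q x → p ≈ₚ q → eval p x ≡ eval q x
eval-≈ p       []      x p≈q = eval-≈0 p x p≈q
eval-≈ []      (b ∷ q) x p≈q = sym (eval-≈0 (b ∷ q) x (sym ∘ p≈q))
eval-≈ (a ∷ p) (b ∷ q) x p≈q =
  cong₂ (λ c v → c + x * v) (p≈q 0) (eval-≈ p q x (p≈q ∘ suc))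

eval-*-rootˡ : ∀ p q x → eval p x ≡ 0ℤ → eval (p *ₚ q) x ≡ 0ℤ
eval-*-rootˡ p q x p[x]≡0 =
  trans (eval-* p q x) (trans (cong (_* eval q x) p[x]≡0) (ℤₚ.*-zeroˡ (eval q x)))

eval-*-rootʳ : ∀ p q x → eval q x ≡ 0ℤ → eval (p *ₚ q) x ≡ 0ℤ
eval-*-rootʳ p q x q[x]≡0 =
  trans (eval-* p q x) (trans (cong (eval p x *_) q[x]≡0) (ℤₚ.*-zeroʳ (eval p x)))

eval-+-root : ∀ p q x → eval q x ≡ 0ℤ → eval (p +ₚ q) x ≡ eval p x
eval-+-root p q x q[x]≡0 =
  trans (eval-+ p q x) (trans (cong (λ c → eval p x + c) q[x]≡0) (ℤₚ.+-identityʳ (eval p x)))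

quot : ℤ → Poly → Poly
quot s []          = []
quot s (a ∷ [])    = []
quot s (a ∷ b ∷ w) = eval (b ∷ w) s ∷ quot s (b ∷ w)

length-quot : ∀ s a w → length (quot s (a ∷ w)) ≡ length w
length-quot s a []      = refl
length-quot s a (b ∷ w) = cong suc (length-quot s b w)

eval-quot : ∀ s v x → eval v x ≡ (x - s) * eval (quot s v) x + eval v s
eval-quot s []          x = sym (trans (ℤₚ.+-identityʳ _) (ℤₚ.*-zeroʳ (x - s)))
eval-quot s (a ∷ [])    x = identity a s x
  where
  identity : ∀ a s x → a + x * 0ℤ ≡ (x - s) * 0ℤ + (a + s * 0ℤ)
  identity = solve-∀
eval-quot s (a ∷ b ∷ w) x =
  trans (cong (λ v → a + x * v) (eval-quot s (b ∷ w) x))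
        (identity a s x (eval (quot s (b ∷ w)) x) (eval (b ∷ w) s))
  where
  identity : ∀ a s x q c → a + x * ((x - s) * q + c) ≡ (x - s) * (c + x * q) + (a + s * c)
  identity = solve-∀

[x-y]∣u[x]-u[y] : ∀ u x y → (x - y) ∣ eval u x - eval u y
[x-y]∣u[x]-u[y] u x y = divides (eval (quot y u) x)
  (trans (cong (_- eval u y) (eval-quot y u x))
         (identity (x - y) (eval (quot y u) x) (eval u y)))
  where
  identity : ∀ d q c → d * q + c - c ≡ q * d
  identity = solve-∀

-- Induction on the length: the quotient by x − s vanishes from s + 1 on, hence is zero, so
-- v vanishes everywhere; then its constant term is v 0 = 0 and its tail vanishes on ℕ⁺.
vanishes-from⇒≈0ₚ : ∀ N v s → length v ≡ N →
                    (∀ k → eval v (+ (s ℕ.+ k)) ≡ 0ℤ) → v ≈ₚ 0ₚ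
vanishes-from⇒≈0ₚ _       []      _ _   _   _ = refl
vanishes-from⇒≈0ₚ (suc N) (a ∷ w) s len v≡0 = λ { zero → a≡0 ; (suc n) → w≈0 n }
  where
  v = a ∷ w
  q = quot (+ s) v
  v[s]≡0 : eval v (+ s) ≡ 0ℤ
  v[s]≡0 = trans (cong (λ m → eval v (+ m)) (sym (ℕₚ.+-identityʳ s))) (v≡0 0)
  q-vanishes : ∀ k → eval q (+ s + + suc k) ≡ 0ℤ
  q-vanishes k = ℤₚ.*-cancelˡ-≡ (+ suc k) _ _ (begin
    + suc k * eval q x                   ≡⟨ identity (+ s) (+ suc k) (eval q x) ⟩
    (x - + s) * eval q x + 0ℤ           ≡⟨ cong (λ c → (x - + s) * eval q x + c) (sym v[s]≡0) ⟩
    (x - + s) * eval q x + eval v (+ s) ≡⟨ sym (eval-quot (+ s) v x) ⟩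
    eval v x                            ≡⟨ v≡0 (suc k) ⟩
    0ℤ                                  ≡⟨ sym (ℤₚ.*-zeroʳ (+ suc k)) ⟩
    + suc k * 0ℤ                        ∎)
    where
    x = + s + + suc k
    identity : ∀ s d q → d * q ≡ (s + d - s) * q + 0ℤ
    identity = solve-∀
  q≈0 : q ≈ₚ 0ₚ
  q≈0 = vanishes-from⇒≈0ₚ N q (suc s) (trans (length-quot (+ s) a w) (ℕₚ.suc-injective len))
    λ k → subst (λ m → eval q (+ m) ≡ 0ℤ) (ℕₚ.+-suc s k) (q-vanishes k)
  v≡0-everywhere : ∀ x → eval v x ≡ 0ℤ
  v≡0-everywhere x = begin
    eval v x                            ≡⟨ eval-quot (+ s) v x ⟩
    (x - + s) * eval q x + eval v (+ s) ≡⟨ cong₂ (λ c d → (x - + s) * c + d) (eval-≈0 q x q≈0) v[s]≡0 ⟩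
    (x - + s) * 0ℤ + 0ℤ                 ≡⟨ trans (ℤₚ.+-identityʳ _) (ℤₚ.*-zeroʳ (x - + s)) ⟩
    0ℤ                                  ∎
  a≡0 : a ≡ 0ℤ
  a≡0 = trans (sym (ℤₚ.+-identityʳ a)) (v≡0-everywhere 0ℤ)
  w≈0 : w ≈ₚ 0ₚ
  w≈0 = vanishes-from⇒≈0ₚ N w 1 (ℕₚ.suc-injective len) λ k →
    ℤₚ.*-cancelˡ-≡ (+ suc k) _ _ (begin
      + suc k * eval w (+ suc k)      ≡⟨ sym (ℤₚ.+-identityˡ _) ⟩
      0ℤ + + suc k * eval w (+ suc k) ≡⟨ cong (λ c → c + + suc k * eval w (+ suc k)) (sym a≡0) ⟩
      eval v (+ suc k)                ≡⟨ v≡0-everywhere (+ suc k) ⟩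
      0ℤ                              ≡⟨ sym (ℤₚ.*-zeroʳ (+ suc k)) ⟩
      + suc k * 0ℤ                    ∎)

agree-on-positives⇒≈ₚ : ∀ p q → (∀ k → eval p (+ suc k) ≡ eval q (+ suc k)) → p ≈ₚ q
agree-on-positives⇒≈ₚ p q p≡q n = difference≡0⇒≡ (coeff p n) (coeff q n) (begin
  coeff p n + -1ℤ * coeff q n            ≡⟨ cong (λ c → coeff p n + c) (sym (coeff-scale -1ℤ q n)) ⟩
  coeff p n + coeff (map (-1ℤ *_) q) n   ≡⟨ sym (coeff-+ p (map (-1ℤ *_) q) n) ⟩
  coeff p-q n                            ≡⟨ vanishes-from⇒≈0ₚ _ p-q 1 refl difference-vanishes n ⟩
  0ℤ                                     ∎)
  where
  p-q = p +ₚ map (-1ℤ *_) q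
  difference≡0⇒≡ : ∀ x y → x + -1ℤ * y ≡ 0ℤ → x ≡ y
  difference≡0⇒≡ x y x-y≡0 =
    trans (identity x y) (trans (cong (λ c → c + y) x-y≡0) (ℤₚ.+-identityˡ y))
    where
    identity : ∀ x y → x ≡ x + -1ℤ * y + y
    identity = solve-∀
  difference-vanishes : ∀ k → eval p-q (+ suc k) ≡ 0ℤ
  difference-vanishes k = begin
    eval p-q x                       ≡⟨ eval-+ p (map (-1ℤ *_) q) x ⟩
    eval p x + eval (map (-1ℤ *_) q) x ≡⟨ cong₂ (λ c d → c + d) (p≡q k) (eval-scale -1ℤ q x) ⟩
    eval q x + -1ℤ * eval q x        ≡⟨ identity (eval q x) ⟩
    0ℤ                               ∎
    where
    x = + suc k
    identity : ∀ y → y + -1ℤ * y ≡ 0ℤ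
    identity = solve-∀

eval-+-product : ∀ c p fs x → eval (c +ₚ foldl _*ₚ_ p fs) x
                              ≡ eval c x + foldl (λ y f → y * eval f x) (eval p x) fs
eval-+-product c p fs x = trans (eval-+ c _ x) (cong (λ y → eval c x + y) (eval-foldl p fs))
  where
  eval-foldl : ∀ p fs → eval (foldl _*ₚ_ p fs) x ≡ foldl (λ y f → y * eval f x) (eval p x) fs
  eval-foldl p []       = refl
  eval-foldl p (f ∷ fs) = trans (eval-foldl (p *ₚ f) fs)
                                (cong (λ y → foldl (λ y f → y * eval f x) y fs) (eval-* p f x))

eval-quot-with : ∀ s v {c} → eval v s ≡ c → ∀ x → eval v x ≡ (x - s) * eval (quot s v) x + c
eval-quot-with s v v[s]≡c x =
  trans (eval-quot s v x) (cong (λ c → (x - s) * eval (quot s v) x + c) v[s]≡c)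

root⇒family1 : ∀ u → eval u (+ 1) ≡ 0ℤ → DegreeAtLeast1 u → Family1 u
root⇒family1 u u[1]≡0 (k , u[k+1]≢0) = q , q≉0 , agree-on-positives⇒≈ₚ u (xm1 *ₚ q) (u≡ ∘ +_ ∘ suc)
  where
  q = quot (+ 1) u
  u≡ : ∀ x → eval u x ≡ eval (xm1 *ₚ q) x
  u≡ x = begin
    eval u x                                ≡⟨ eval-quot-with (+ 1) u u[1]≡0 x ⟩
    (x - + 1) * eval q x + 0ℤ               ≡⟨ identity x (eval q x) ⟩
    eval xm1 x * eval q x                   ≡⟨ sym (eval-* xm1 q x) ⟩
    eval (xm1 *ₚ q) x                       ∎
    where
    identity : ∀ x y → (x - + 1) * y + 0ℤ ≡ (-1ℤ + x * (1ℤ + x * 0ℤ)) * y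
    identity = solve-∀
  q≉0 : ¬ q ≈ₚ 0ₚ
  q≉0 q≈0 = u[k+1]≢0 (agree-on-positives⇒≈ₚ u 0ₚ (λ k → begin
    eval u (+ suc k)              ≡⟨ eval-quot-with (+ 1) u u[1]≡0 (+ suc k) ⟩
    + k * eval q (+ suc k) + 0ℤ   ≡⟨ cong (λ c → + k * c + 0ℤ) (eval-≈0 q (+ suc k) q≈0) ⟩
    + k * 0ℤ + 0ℤ                 ≡⟨ trans (ℤₚ.+-identityʳ _) (ℤₚ.*-zeroʳ (+ k)) ⟩
    0ℤ                            ∎) (suc k))

values⇒family2 : ∀ u → eval u (+ 1) ≡ + 2 → eval u (+ 2) ≡ 0ℤ → Family2 u
values⇒family2 u u[1]≡2 u[2]≡0 =
  q₂ , agree-on-positives⇒≈ₚ u (lin2 +ₚ ((q₂ *ₚ xm1) *ₚ xm2)) (u≡ ∘ +_ ∘ suc)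
  where
  q₁ = quot (+ 1) u
  q₂ = quot (+ 2) q₁
  q₁[2]≡-2 : eval q₁ (+ 2) ≡ -[1+ 1 ]
  q₁[2]≡-2 = affine-injective (+ 1) (+ 2) (trans (sym (eval-quot-with (+ 1) u u[1]≡2 (+ 2))) u[2]≡0)
  u≡ : ∀ x → eval u x ≡ eval (lin2 +ₚ ((q₂ *ₚ xm1) *ₚ xm2)) x
  u≡ x = begin
    eval u x
      ≡⟨ eval-quot-with (+ 1) u u[1]≡2 x ⟩
    (x - + 1) * eval q₁ x + + 2
      ≡⟨ cong (λ c → (x - + 1) * c + + 2) (eval-quot-with (+ 2) q₁ q₁[2]≡-2 x) ⟩
    (x - + 1) * ((x - + 2) * eval q₂ x + -[1+ 1 ]) + + 2
      ≡⟨ identity x (eval q₂ x) ⟩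
    eval lin2 x + eval q₂ x * eval xm1 x * eval xm2 x
      ≡⟨ sym (eval-+-product lin2 q₂ (xm1 ∷ xm2 ∷ []) x) ⟩
    eval (lin2 +ₚ ((q₂ *ₚ xm1) *ₚ xm2)) x
      ∎
    where
    identity : ∀ x y → (x - + 1) * ((x - + 2) * y + -[1+ 1 ]) + + 2
                     ≡ (+ 4 + x * (-[1+ 1 ] + x * 0ℤ))
                       + y * (-1ℤ + x * (1ℤ + x * 0ℤ)) * (-[1+ 1 ] + x * (1ℤ + x * 0ℤ))
    identity = solve-∀

values⇒family3 : ∀ u → eval u (+ 1) ≡ + 2 → eval u (+ 2) ≡ + 3 → eval u (+ 3) ≡ 0ℤ → Family3 u
values⇒family3 u u[1]≡2 u[2]≡3 u[3]≡0 =
  q₃ , agree-on-positives⇒≈ₚ u (quad3 +ₚ (((q₃ *ₚ xm1) *ₚ xm2) *ₚ xm3)) (u≡ ∘ +_ ∘ suc)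
  where
  q₁ = quot (+ 1) u
  q₂ = quot (+ 2) q₁
  q₃ = quot (+ 3) q₂
  q₁[2]≡1 : eval q₁ (+ 2) ≡ + 1
  q₁[2]≡1 = affine-injective (+ 1) (+ 2) (trans (sym (eval-quot-with (+ 1) u u[1]≡2 (+ 2))) u[2]≡3)
  q₁[3]≡-1 : eval q₁ (+ 3) ≡ -1ℤ
  q₁[3]≡-1 = affine-injective (+ 2) (+ 2) (trans (sym (eval-quot-with (+ 1) u u[1]≡2 (+ 3))) u[3]≡0)
  q₂[3]≡-2 : eval q₂ (+ 3) ≡ -[1+ 1 ]
  q₂[3]≡-2 =
    affine-injective (+ 1) (+ 1) (trans (sym (eval-quot-with (+ 2) q₁ q₁[2]≡1 (+ 3))) q₁[3]≡-1)
  u≡ : ∀ x → eval u x ≡ eval (quad3 +ₚ (((q₃ *ₚ xm1) *ₚ xm2) *ₚ xm3)) x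
  u≡ x = begin
    eval u x
      ≡⟨ eval-quot-with (+ 1) u u[1]≡2 x ⟩
    (x - + 1) * eval q₁ x + + 2
      ≡⟨ cong (λ c → (x - + 1) * c + + 2) (eval-quot-with (+ 2) q₁ q₁[2]≡1 x) ⟩
    (x - + 1) * ((x - + 2) * eval q₂ x + + 1) + + 2
      ≡⟨ cong (λ c → (x - + 1) * ((x - + 2) * c + + 1) + + 2) (eval-quot-with (+ 3) q₂ q₂[3]≡-2 x) ⟩
    (x - + 1) * ((x - + 2) * ((x - + 3) * eval q₃ x + -[1+ 1 ]) + + 1) + + 2
      ≡⟨ identity x (eval q₃ x) ⟩
    eval quad3 x + eval q₃ x * eval xm1 x * eval xm2 x * eval xm3 x
      ≡⟨ sym (eval-+-product quad3 q₃ (xm1 ∷ xm2 ∷ xm3 ∷ []) x) ⟩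
    eval (quad3 +ₚ (((q₃ *ₚ xm1) *ₚ xm2) *ₚ xm3)) x
      ∎
    where
    identity : ∀ x y → (x - + 1) * ((x - + 2) * ((x - + 3) * y + -[1+ 1 ]) + + 1) + + 2
                     ≡ (-[1+ 2 ] + x * (+ 7 + x * (-[1+ 1 ] + x * 0ℤ)))
                       + y * (-1ℤ + x * (1ℤ + x * 0ℤ)) * (-[1+ 1 ] + x * (1ℤ + x * 0ℤ))
                           * (-[1+ 2 ] + x * (1ℤ + x * 0ℤ))
    identity = solve-∀

eval-xp1 : ∀ x → eval xp1 x ≡ 1ℤ + x
eval-xp1 = identity
  where
  identity : ∀ x → 1ℤ + x * (1ℤ + x * 0ℤ) ≡ 1ℤ + x
  identity = solve-∀

values⇒family4 : ∀ u → (∀ k → eval u (+ suc k) ≡ + suc (suc k)) → Family4 u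
values⇒family4 u u[1+k]≡2+k =
  agree-on-positives⇒≈ₚ u xp1 λ k → trans (u[1+k]≡2+k k) (sym (eval-xp1 (+ suc k)))

family1-root : ∀ u → Family1 u → eval u (+ 1) ≡ 0ℤ
family1-root u (p , _ , u≈) = trans (eval-≈ u (xm1 *ₚ p) (+ 1) u≈) (eval-*-rootˡ xm1 p (+ 1) refl)

family2-values : ∀ u → Family2 u → eval u (+ 1) ≡ + 2 × eval u (+ 2) ≡ 0ℤ
family2-values u (p , u≈) =
    trans (eval-≈ u f₂ (+ 1) u≈) (eval-+-root lin2 (p₁₂ *ₚ xm2) (+ 1)
      (eval-*-rootˡ p₁₂ xm2 (+ 1) (eval-*-rootʳ p xm1 (+ 1) refl)))
  , trans (eval-≈ u f₂ (+ 2) u≈) (eval-+-root lin2 (p₁₂ *ₚ xm2) (+ 2)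
      (eval-*-rootʳ p₁₂ xm2 (+ 2) refl))
  where
  p₁₂ = p *ₚ xm1
  f₂  = lin2 +ₚ (p₁₂ *ₚ xm2)

family3-values : ∀ u → Family3 u → eval u (+ 1) ≡ + 2 × eval u (+ 2) ≡ + 3 × eval u (+ 3) ≡ 0ℤ
family3-values u (p , u≈) =
    trans (eval-≈ u f₃ (+ 1) u≈) (eval-+-root quad3 (p₁₂₃ *ₚ xm3) (+ 1)
      (eval-*-rootˡ p₁₂₃ xm3 (+ 1) (eval-*-rootˡ p₁₂ xm2 (+ 1) (eval-*-rootʳ p xm1 (+ 1) refl))))
  , trans (eval-≈ u f₃ (+ 2) u≈) (eval-+-root quad3 (p₁₂₃ *ₚ xm3) (+ 2)
      (eval-*-rootˡ p₁₂₃ xm3 (+ 2) (eval-*-rootʳ p₁₂ xm2 (+ 2) refl)))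
  , trans (eval-≈ u f₃ (+ 3) u≈) (eval-+-root quad3 (p₁₂₃ *ₚ xm3) (+ 3)
      (eval-*-rootʳ p₁₂₃ xm3 (+ 3) refl))
  where
  p₁₂  = p *ₚ xm1
  p₁₂₃ = p₁₂ *ₚ xm2
  f₃   = quad3 +ₚ (p₁₂₃ *ₚ xm3)

prime>1 : ∀ {p} → Prime p → 1 < p
prime>1 {p} pr = ℕ.nonTrivial⇒n>1 p {{prime⇒nonTrivial pr}}

prime≢1 : ∀ {p} → Prime p → p ≢ 1
prime≢1 pr refl = ¬prime[1] pr

prime∤1 : ∀ {p} → Prime p → ¬ p ∣ₙ 1
prime∤1 pr p∣1 = prime≢1 pr (ℕ∣.∣1⇒≡1 p∣1)

prime∣prime⇒≡ : ∀ {p q} → Prime p → Prime q → p ∣ₙ q → p ≡ q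
prime∣prime⇒≡ pr qr p∣q with prime⇒irreducible qr p∣q
... | inj₁ p≡1 = ⊥-elim (prime≢1 pr p≡1)
... | inj₂ p≡q = p≡q

prime-divisor : ∀ m → 1 < m → ∃[ p ] Prime p × p ∣ₙ m
prime-divisor m@(suc _) 1<m with factorise m
... | record { factors = [] ; isFactorisation = m≡1 } = ⊥-elim (ℕₚ.<⇒≢ 1<m (sym m≡1))
... | record { factors = p ∷ ps ; isFactorisation = m≡p*ps ; factorsPrime = pr ∷ _ } =
  p , pr , subst (p ∣ₙ_) (sym m≡p*ps) (ℕ∣.m∣m*n (product ps))

k∣n! : ∀ {k n} → 0 < k → k ≤ n → k ∣ₙ n !
k∣n! {suc k} _ k≤n = ℕ∣.∣-trans (ℕ∣.m∣m*n (k !)) (ℕ∣.m≤n⇒m!∣n! k≤n)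

prime-above : ∀ N → ∃[ p ] Prime p × N < p
prime-above N with prime-divisor (N ! ℕ.+ 1) (ℕₚ.+-monoˡ-≤ 1 (ℕₚ.1≤n! N))
... | p , pr , p∣N!+1 with N ℕ.<? p
...   | yes N<p = p , pr , N<p
...   | no  N≮p = ⊥-elim (prime∤1 pr (ℕ∣.∣m+n∣m⇒∣n p∣N!+1 p∣N!))
  where
  p∣N! : p ∣ₙ N !
  p∣N! = k∣n! (ℕₚ.<⇒≤ (prime>1 pr)) (ℕₚ.≮⇒≥ N≮p)

data PrimeDivisorView (z : ℤ) : Set where
  zero      : z ≡ 0ℤ → PrimeDivisorView z
  one       : z ≡ 1ℤ → PrimeDivisorView z
  minus-one : z ≡ -1ℤ → PrimeDivisorView z
  divisor   : ∀ p → Prime p → + p ∣ z → PrimeDivisorView z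

primeDivisorView : ∀ z → PrimeDivisorView z
primeDivisorView (+ zero)          = zero refl
primeDivisorView (+ suc zero)      = one refl
primeDivisorView -[1+ zero ]       = minus-one refl
primeDivisorView z@(+ suc (suc m)) with prime-divisor (2 ℕ.+ m) (s≤s (s≤s z≤n))
... | p , pr , p∣z = divisor p pr (∣ᵤ⇒∣ p∣z)
primeDivisorView z@(-[1+ suc m ])  with prime-divisor (2 ℕ.+ m) (s≤s (s≤s z≤n))
... | p , pr , p∣z = divisor p pr (∣ᵤ⇒∣ p∣z)

module DivisibleWithSmoothTranslates
  (n : ℕ) (D : ℤ)
  (divisible : ∀ {k} → 0 < k → k ≤ n → + k ∣ D)
  (smooth : ∀ {m r} → 0 < m → m ≤ suc n → Prime r → + r ∣ D + + m → r ≤ suc n)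
  where

  translate≢0 : ∀ {m} → 0 < m → m ≤ suc n → D + + m ≢ 0ℤ
  translate≢0 0<m m≤1+n D+m≡0 with prime-above (suc n)
  ... | p , pr , 1+n<p =
    ℕₚ.<⇒≱ 1+n<p (smooth 0<m m≤1+n pr (subst (+ p ∣_) (sym D+m≡0) (divides 0ℤ refl)))

  prime-divisor-of-translate : ∀ {m r} → 0 < m → m ≤ suc n → Prime r → + r ∣ D + + m →
                               r ∣ₙ m ⊎ r ≡ suc n
  prime-divisor-of-translate {m} 0<m m≤1+n pr r∣D+m
    with ℕₚ.m≤n⇒m<n∨m≡n (smooth 0<m m≤1+n pr r∣D+m)
  ... | inj₂ r≡1+n = inj₂ r≡1+n
  ... | inj₁ r<1+n = inj₁ (∣⇒∣ᵤ (subst (_ ∣_) (identity D (+ m))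
          (∣m∣n⇒∣m-n r∣D+m (divisible (ℕₚ.<⇒≤ (prime>1 pr)) (ℕₚ.≤-pred r<1+n)))))
    where
    identity : ∀ D m → D + m - D ≡ m
    identity = solve-∀

  -- Primes below n + 1 divide D, so none divides D + 1: thus D + 1 = ±1, or n + 1 is a prime
  -- dividing D + 1.  In that case every prime factor of D + (n + 1) would be n + 1 again,
  -- which cannot divide both, so D + (n + 1) = ±1.
  1+n-prime⇒D≡-[2+n] : Prime (suc n) → + suc n ∣ D + 1ℤ → D ≡ - + (2 ℕ.+ n)
  1+n-prime⇒D≡-[2+n] pr 1+n∣D+1 with primeDivisorView (D + + suc n)
  ... | zero D+1+n≡0 = ⊥-elim (translate≢0 (s≤s z≤n) ℕₚ.≤-refl D+1+n≡0)
  ... | one D+1+n≡1 = ⊥-elim (translate≢0 (ℕₚ.≤-pred (prime>1 pr)) (ℕₚ.n≤1+n n)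
          (trans (identity D (+ n)) (cong (_- 1ℤ) D+1+n≡1)))
    where
    identity : ∀ D n → D + n ≡ D + (1ℤ + n) - 1ℤ
    identity = solve-∀
  ... | minus-one D+1+n≡-1 = solve-for-left D+1+n≡-1
  ... | divisor q qr q∣D+1+n =
    ⊥-elim (ℕₚ.n≮n n (ℕ∣.∣⇒≤ {{ℕ.>-nonZero (ℕₚ.≤-pred (prime>1 pr))}} 1+n∣n))
    where
    q≡1+n : q ≡ suc n
    q≡1+n with prime-divisor-of-translate (s≤s z≤n) ℕₚ.≤-refl qr q∣D+1+n
    ... | inj₁ q∣1+n = prime∣prime⇒≡ qr pr q∣1+n
    ... | inj₂ q≡1+n = q≡1+n
    identity : ∀ D n → D + (1ℤ + n) - (D + 1ℤ) ≡ n
    identity = solve-∀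
    1+n∣n : suc n ∣ₙ n
    1+n∣n = ∣⇒∣ᵤ (subst (_ ∣_) (identity D (+ n))
      (∣m∣n⇒∣m-n (subst (λ k → + k ∣ D + + suc n) q≡1+n q∣D+1+n) 1+n∣D+1))

  D≡0⊎D≡-[2+n] : D ≡ 0ℤ ⊎ D ≡ - + (2 ℕ.+ n)
  D≡0⊎D≡-[2+n] with primeDivisorView (D + 1ℤ)
  ... | zero D+1≡0       = ⊥-elim (translate≢0 (s≤s z≤n) (s≤s z≤n) D+1≡0)
  ... | one D+1≡1        = inj₁ (solve-for-left D+1≡1)
  ... | minus-one D+1≡-1 with n ℕ.≤? 0
  ...   | yes n≤0 =
    inj₂ (subst (λ k → D ≡ - + (2 ℕ.+ k)) (sym (ℕₚ.n≤0⇒n≡0 n≤0)) (solve-for-left D+1≡-1))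
  ...   | no  n≰0 =
    ⊥-elim (translate≢0 (s≤s z≤n) (s≤s (ℕₚ.≰⇒> n≰0)) (trans (identity D) (cong (_+ 1ℤ) D+1≡-1)))
    where
    identity : ∀ D → D + + 2 ≡ D + 1ℤ + 1ℤ
    identity = solve-∀
  D≡0⊎D≡-[2+n] | divisor r pr r∣D+1 with prime-divisor-of-translate (s≤s z≤n) (s≤s z≤n) pr r∣D+1
  ... | inj₁ r∣1    = ⊥-elim (prime∤1 pr r∣1)
  ... | inj₂ refl   = inj₂ (1+n-prime⇒D≡-[2+n] pr r∣D+1)

  D≡-[2+n]⇒n≤2 : D ≡ - + (2 ℕ.+ n) → n ≤ 2
  D≡-[2+n]⇒n≤2 D≡-[2+n] with n ℕ.≤? 0
  ... | yes n≤0 = ℕₚ.≤-trans n≤0 z≤n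
  ... | no  n≰0 = ℕ∣.∣⇒≤ (ℕ∣.∣m+n∣m⇒∣n (subst (n ∣ₙ_) (ℕₚ.+-comm 2 n) n∣2+n) ℕ∣.∣-refl)
    where
    n∣2+n : n ∣ₙ 2 ℕ.+ n
    n∣2+n = ∣⇒∣ᵤ (subst (+ n ∣_) D≡-[2+n] (divisible (ℕₚ.≰⇒> n≰0) ℕₚ.≤-refl))

module Orbit (u : Poly) (x₀ : ℤ) where

  orbit : ℕ → ℤ
  orbit m = iterate u m x₀

  orbit-shift : ∀ {d} k i j → d ∣ orbit i - orbit j → d ∣ orbit (k ℕ.+ i) - orbit (k ℕ.+ j)
  orbit-shift zero    i j d∣ = d∣
  orbit-shift (suc k) i j d∣ = ∣-trans (orbit-shift k i j d∣) ([x-y]∣u[x]-u[y] u _ _)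

  orbit-periodic : ∀ {d n j} → j ≤ n → d ∣ orbit (suc n) - orbit j →
                   ∀ M → ∃[ M′ ] M′ ≤ n × d ∣ orbit M - orbit M′
  orbit-periodic {d} {n} {j} j≤n d∣ M = go M (<-wellFounded M)
    where
    go : ∀ M → Acc _<_ M → ∃[ M′ ] M′ ≤ n × d ∣ orbit M - orbit M′
    go M (acc rec) with M ℕ.≤? n
    ... | yes M≤n = M , M≤n , divides 0ℤ (ℤₚ.+-inverseʳ (orbit M))
    ... | no  M≰n with ℕₚ.m≤n⇒∃[o]m+o≡n (ℕₚ.≰⇒> M≰n)
    ...   | k , refl with go (k ℕ.+ j) (rec k+j<1+n+k)
      where
      k+j<1+n+k : k ℕ.+ j < suc n ℕ.+ k
      k+j<1+n+k = subst (k ℕ.+ j <_) (ℕₚ.+-comm k (suc n)) (ℕₚ.+-monoʳ-< k (s≤s j≤n))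
    ...     | M′ , M′≤n , d∣[k+j]-M′ =
      M′ , M′≤n , ∣-difference-trans {x = orbit (suc n ℕ.+ k)} {orbit (k ℕ.+ j)} {orbit M′}
                    d∣1+n+k-[k+j] d∣[k+j]-M′
      where
      d∣1+n+k-[k+j] : d ∣ orbit (suc n ℕ.+ k) - orbit (k ℕ.+ j)
      d∣1+n+k-[k+j] = subst (λ i → d ∣ orbit i - orbit (k ℕ.+ j)) (ℕₚ.+-comm k (suc n))
                        (orbit-shift k (suc n) j d∣)

module LocallyNilpotentAtOne (u : Poly) (ln : LocallyNilpotentAt u 1ℤ) where
  open Orbit u 1ℤ

  Linear : ℕ → Set
  Linear n = ∀ i → i ≤ n → orbit i ≡ + suc i

  linear₀ : Linear 0
  linear₀ zero z≤n = refl

  Linear-suc : ∀ {n} → Linear n → orbit (suc n) ≡ + suc (suc n) → Linear (suc n)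
  Linear-suc linear next i i≤1+n with ℕₚ.m≤n⇒m<n∨m≡n i≤1+n
  ... | inj₁ i<1+n = linear i (ℕₚ.≤-pred i<1+n)
  ... | inj₂ refl  = next

  prime-divisor-bound : ∀ {n j r} → Linear n → j ≤ n → Prime r →
                  + r ∣ orbit (suc n) - orbit j → r ≤ suc n
  prime-divisor-bound {r = r} linear j≤n pr r∣ with ln r pr
  ... | M , r∣orbit[1+M] with orbit-periodic j≤n r∣ (suc M)
  ...   | M′ , M′≤n , r∣difference = ℕₚ.≤-trans (ℕ∣.∣⇒≤ r∣1+M′) (s≤s M′≤n)
    where
    identity : ∀ x y → x - (x - y) ≡ y
    identity = solve-∀
    r∣1+M′ : r ∣ₙ suc M′
    r∣1+M′ = ∣⇒∣ᵤ (subst (+ r ∣_) (trans (identity (orbit (suc M)) (orbit M′)) (linear M′ M′≤n))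
               (∣m∣n⇒∣m-n {m = orbit (suc M)} (∣ᵤ⇒∣ r∣orbit[1+M]) r∣difference))

  divisible : ∀ {n k} → Linear n → 0 < k → k ≤ n → + k ∣ orbit (suc n) - + (2 ℕ.+ n)
  divisible {k = k} linear 0<k k≤n with ℕₚ.m≤n⇒∃[o]m+o≡n k≤n
  ... | l , refl = subst (+ k ∣_) (identity (orbit (suc (k ℕ.+ l))) (+ k) (+ l))
                     (∣m∣n⇒∣m-n k∣shifted ∣-refl)
    where
    identity : ∀ c k l → c - (1ℤ + (1ℤ + l)) - k ≡ c - (1ℤ + (1ℤ + (k + l)))
    identity = solve-∀
    difference : ∀ k l → 1ℤ + (k + l) - (1ℤ + l) ≡ 1ℤ * k
    difference = solve-∀
    1+l≤k+l : suc l ≤ k ℕ.+ l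
    1+l≤k+l = ℕₚ.+-monoˡ-≤ l 0<k
    k∣shifted : + k ∣ orbit (suc (k ℕ.+ l)) - + (2 ℕ.+ l)
    k∣shifted = subst (λ c → + k ∣ orbit (suc (k ℕ.+ l)) - c) (linear (suc l) 1+l≤k+l)
      (orbit-shift 1 (k ℕ.+ l) l (divides 1ℤ (begin
      orbit (k ℕ.+ l) - orbit l   ≡⟨ cong₂ _-_ (linear (k ℕ.+ l) ℕₚ.≤-refl) (linear l (ℕₚ.m≤n+m l k)) ⟩
      + suc (k ℕ.+ l) - + suc l   ≡⟨ difference (+ k) (+ l) ⟩
      1ℤ * + k                    ∎)))

  -- D + m is orbit (n+1) − orbit j for j = n + 1 − m.
  translate-smooth : ∀ {n m r} → Linear n → 0 < m → m ≤ suc n → Prime r →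
                     + r ∣ orbit (suc n) - + (2 ℕ.+ n) + + m → r ≤ suc n
  translate-smooth {m = suc m′} {r} linear _ m≤1+n pr r∣ with ℕₚ.m≤n⇒∃[o]m+o≡n m≤1+n
  ... | j , refl = prime-divisor-bound linear (ℕₚ.m≤n+m j m′) pr
                     (subst (λ c → + r ∣ orbit (suc (m′ ℕ.+ j)) - c) (sym (linear j (ℕₚ.m≤n+m j m′)))
                       (subst (+ r ∣_) (identity (orbit (suc (m′ ℕ.+ j))) (+ m′) (+ j)) r∣))
    where
    identity : ∀ c m j → c - (1ℤ + (1ℤ + (m + j))) + (1ℤ + m) ≡ c - (1ℤ + j)
    identity = solve-∀

  module Translates {n} (linear : Linear n) =
    DivisibleWithSmoothTranslates n (orbit (suc n) - + (2 ℕ.+ n))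
      (divisible linear) (translate-smooth linear)

  next-value : ∀ {n} → Linear n → orbit (suc n) ≡ + (2 ℕ.+ n) ⊎ (orbit (suc n) ≡ 0ℤ × n ≤ 2)
  next-value {n} linear with Translates.D≡0⊎D≡-[2+n] linear
  ... | inj₁ D≡0      = inj₁ (ℤₚ.i-j≡0⇒i≡j _ _ D≡0)
  ... | inj₂ D≡-[2+n] = inj₂ ( trans (solve-for-left D≡-[2+n]) (ℤₚ.+-inverseʳ (- + (2 ℕ.+ n)))
                             , Translates.D≡-[2+n]⇒n≤2 linear D≡-[2+n])

  linear-from-3 : Linear 3 → ∀ n → Linear (3 ℕ.+ n)
  linear-from-3 linear₃ zero    = linear₃
  linear-from-3 linear₃ (suc n) with next-value (linear-from-3 linear₃ n)
  ... | inj₁ next           = Linear-suc (linear-from-3 linear₃ n) next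
  ... | inj₂ (_ , 3+n≤2)    = ⊥-elim (ℕₚ.<⇒≱ (s≤s (s≤s (s≤s z≤n))) 3+n≤2)

  eval-at-orbit : ∀ {k x} → orbit k ≡ x → eval u x ≡ orbit (suc k)
  eval-at-orbit orbit[k]≡x = cong (eval u) (sym orbit[k]≡x)

  classification : DegreeAtLeast1 u → Family1 u ⊎ Family2 u ⊎ Family3 u ⊎ Family4 u
  classification deg with next-value linear₀
  ... | inj₂ (o₁≡0 , _) = inj₁ (root⇒family1 u o₁≡0 deg)
  ... | inj₁ o₁≡2 with next-value (Linear-suc {0} linear₀ o₁≡2)
  ...   | inj₂ (o₂≡0 , _) =
    inj₂ (inj₁ (values⇒family2 u o₁≡2 (trans (eval-at-orbit {1} o₁≡2) o₂≡0)))
  ...   | inj₁ o₂≡3 with next-value (Linear-suc {1} (Linear-suc linear₀ o₁≡2) o₂≡3)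
  ...     | inj₂ (o₃≡0 , _) =
    inj₂ (inj₂ (inj₁ (values⇒family3 u o₁≡2 (trans (eval-at-orbit {1} o₁≡2) o₂≡3)
                                            (trans (eval-at-orbit {2} o₂≡3) o₃≡0))))
  ...     | inj₁ o₃≡4 =
    inj₂ (inj₂ (inj₂ (values⇒family4 u λ k → trans (eval-at-orbit {k} (orbit≡ k)) (orbit≡ (suc k)))))
    where
    linear₃ : Linear 3
    linear₃ = Linear-suc {2} (Linear-suc {1} (Linear-suc linear₀ o₁≡2) o₂≡3) o₃≡4
    orbit≡ : ∀ i → orbit i ≡ + suc i
    orbit≡ i = linear-from-3 linear₃ i i (ℕₚ.m≤n+m i 3)

family4-orbit : ∀ u → Family4 u → ∀ m → iterate u m (+ 1) ≡ + suc m
family4-orbit u u≈xp1 zero    = refl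
family4-orbit u u≈xp1 (suc m) =
  trans (cong (eval u) (family4-orbit u u≈xp1 m))
        (trans (eval-≈ u xp1 _ u≈xp1) (eval-xp1 (+ suc m)))

family1-index : ∀ u → Family1 u → NilpotencyIndex u (+ 1) 1
family1-index u f = s≤s z≤n , family1-root u f , λ m 1≤m m<1 → ⊥-elim (ℕₚ.<⇒≱ m<1 1≤m)

family2-index : ∀ u → Family2 u → NilpotencyIndex u (+ 1) 2
family2-index u f with family2-values u f
... | u[1]≡2 , u[2]≡0 = s≤s z≤n , trans (cong (eval u) u[1]≡2) u[2]≡0 , earlier
  where
  earlier : ∀ m → 1 ≤ m → m < 2 → ¬ iterate u m (+ 1) ≡ 0ℤ
  earlier 1 _ _ u[1]≡0 with trans (sym u[1]≡2) u[1]≡0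
  ... | ()
  earlier (suc (suc m)) _ (s≤s (s≤s ()))

family3-index : ∀ u → Family3 u → NilpotencyIndex u (+ 1) 3
family3-index u f with family3-values u f
... | u[1]≡2 , u[2]≡3 , u[3]≡0 =
  s≤s z≤n , trans (cong (eval u) u[u[1]]≡3) u[3]≡0 , earlier
  where
  u[u[1]]≡3 : eval u (eval u (+ 1)) ≡ + 3
  u[u[1]]≡3 = trans (cong (eval u) u[1]≡2) u[2]≡3
  earlier : ∀ m → 1 ≤ m → m < 3 → ¬ iterate u m (+ 1) ≡ 0ℤ
  earlier 1 _ _ u[1]≡0 with trans (sym u[1]≡2) u[1]≡0
  ... | ()
  earlier 2 _ _ u[u[1]]≡0 with trans (sym u[u[1]]≡3) u[u[1]]≡0
  ... | ()
  earlier (suc (suc (suc m))) _ (s≤s (s≤s (s≤s ())))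

index⇒nilpotent : ∀ u {r k} → NilpotencyIndex u r k → NilpotentAt u r
index⇒nilpotent u {k = suc k} (_ , u^[1+k][r]≡0 , _) = k , u^[1+k][r]≡0

nilpotent⇒locally-nilpotent : ∀ u {r} → NilpotentAt u r → LocallyNilpotentAt u r
nilpotent⇒locally-nilpotent u (m , u^[1+m][r]≡0) p _ =
  m , subst (+ p Unsigned.∣_) (sym u^[1+m][r]≡0) (p ℕ∣.∣0)

family4-locally-nilpotent : ∀ u → Family4 u → LocallyNilpotentAt u (+ 1)
family4-locally-nilpotent u u≈xp1 zero          pr = ⊥-elim (¬prime[0] pr)
family4-locally-nilpotent u u≈xp1 (suc zero)    pr = ⊥-elim (¬prime[1] pr)
family4-locally-nilpotent u u≈xp1 (suc (suc m)) _  =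
  m , subst (+ suc (suc m) Unsigned.∣_) (sym (family4-orbit u u≈xp1 (suc m))) ℕ∣.∣-refl

family4-not-nilpotent : ∀ u → Family4 u → ¬ NilpotentAt u (+ 1)
family4-not-nilpotent u u≈xp1 (m , u^[1+m][1]≡0)
  with trans (sym (family4-orbit u u≈xp1 (suc m))) u^[1+m][1]≡0
... | ()

families⇒locally-nilpotent : ∀ u → Family1 u ⊎ Family2 u ⊎ Family3 u ⊎ Family4 u →
                             LocallyNilpotentAt u (+ 1)
families⇒locally-nilpotent u (inj₁ f) =
  nilpotent⇒locally-nilpotent u (index⇒nilpotent u (family1-index u f))
families⇒locally-nilpotent u (inj₂ (inj₁ f)) =
  nilpotent⇒locally-nilpotent u (index⇒nilpotent u (family2-index u f))
families⇒locally-nilpotent u (inj₂ (inj₂ (inj₁ f))) =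
  nilpotent⇒locally-nilpotent u (index⇒nilpotent u (family3-index u f))
families⇒locally-nilpotent u (inj₂ (inj₂ (inj₂ f))) =
  family4-locally-nilpotent u f

theorem4p1 :
    (∀ (u : Poly) → DegreeAtLeast1 u →
      (LocallyNilpotentAt u (+ 1) →
        Family1 u ⊎ Family2 u ⊎ Family3 u ⊎ Family4 u)
      × (Family1 u ⊎ Family2 u ⊎ Family3 u ⊎ Family4 u →
        LocallyNilpotentAt u (+ 1)))
    × (∀ (u : Poly) → Family1 u → NilpotencyIndex u (+ 1) 1)
    × (∀ (u : Poly) → Family2 u → NilpotencyIndex u (+ 1) 2)
    × (∀ (u : Poly) → Family3 u → NilpotencyIndex u (+ 1) 3)
    × (∀ (u : Poly) → Family4 u →
        LocallyNilpotentAt u (+ 1) × ¬ NilpotentAt u (+ 1))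
theorem4p1 =
    (λ u deg → (λ ln → LocallyNilpotentAtOne.classification u ln deg)
             , families⇒locally-nilpotent u)
  , family1-index , family2-index , family3-index
  , λ u f → family4-locally-nilpotent u f , family4-not-nilpotent u f
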